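{- Let $\Sigma=(G,\sigma)$ be a signed graph with $n$ vertices, $m$ edges, balanced clique number $\omega_b(\Sigma)$ and frustration index $\epsilon(\Sigma)$. Then $$m\le \epsilon(\Sigma)+\frac{n^2}{2}\Big(1-\frac{1}{\omega_b(\Sigma)}\Big).$$
   Context: A signed graph $\Sigma=(G,\sigma)$ consists of a finite simple graph $G=(V,E)$ and a sign function $\sigma:E\to\{1,-1\}$. The sign of a cycle is the product of its edge signs; a signed graph is balanced if every cycle has sign $1$. The frustration index $\epsilon(\Sigma)$ is the minimum number of edges whose deletion yields a balanced signed graph. The balanced clique number $\omega_b(\Sigma)$ is the maximum number of vertices of a complete subgraph of $G$ that is balanced with the inherited signs. -}

module Defs where

open import Data.Nat using (ℕ; zero; suc; _+_; _*_; _<ᵇ_)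
open import Data.Nat.DivMod using (_mod_)
open import Data.Bool using (Bool; true; false; _∧_; not; T; if_then_else_)
open import Data.Fin using (Fin; toℕ)
open import Data.Fin.Subset using (Subset; _∈_; ∣_∣)
open import Data.Vec.Functional using (foldr)
open import Data.Sign using (Sign) renaming (_*_ to _*ₛ_)
open import Data.Product using (Σ; _×_; _,_)
open import Function.Definitions using (Injective)
open import Relation.Binary.PropositionalEquality using (_≡_)

EdgeRel : ℕ → Set
EdgeRel n = Fin n → Fin n → Bool

record SimpleGraph (n : ℕ) : Set where
  field
    adj     : EdgeRel n
    adj-sym : ∀ i j → adj i j ≡ adj j i
    adj-irr : ∀ i → adj i i ≡ false

-- A signed graph: a simple graph together with a sign on each edge
-- (given as a symmetric function on pairs; only values on edges matter).
record SignedGraph (n : ℕ) : Set where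
  field
    graph   : SimpleGraph n
    σ       : Fin n → Fin n → Sign
    σ-sym   : ∀ i j → σ i j ≡ σ j i
  open SimpleGraph graph public

countEdges : ∀ {n} → EdgeRel n → ℕ
countEdges {n} r =
  foldr _+_ 0 (λ (i : Fin n) →
    foldr _+_ 0 (λ (j : Fin n) →
      if r i j ∧ (toℕ i <ᵇ toℕ j) then 1 else 0))

cycSuc : ∀ {m} → Fin (suc m) → Fin (suc m)
cycSuc {m} i = suc (toℕ i) mod suc m

record Cycle {n : ℕ} (r : EdgeRel n) : Set where
  field
    len   : ℕ
    vert  : Fin (3 + len) → Fin n
    inj   : Injective _≡_ _≡_ vert
    edges : ∀ i → T (r (vert i) (vert (cycSuc i)))

cycleSign : ∀ {n} {r : EdgeRel n} → (Fin n → Fin n → Sign) → Cycle r → Sign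
cycleSign σ c = foldr _*ₛ_ Sign.+ (λ i → σ (vert i) (vert (cycSuc i)))
  where open Cycle c

Balanced : ∀ {n} → EdgeRel n → (Fin n → Fin n → Sign) → Set
Balanced r σ = (c : Cycle r) → cycleSign σ c ≡ Sign.+

record EdgeSubset {n : ℕ} (Σg : SignedGraph n) : Set where
  field
    del     : EdgeRel n
    del-sym : ∀ i j → del i j ≡ del j i
    del-sub : ∀ i j → T (del i j) → T (SignedGraph.adj Σg i j)

deleteEdges : ∀ {n} (Σg : SignedGraph n) → EdgeSubset Σg → EdgeRel n
deleteEdges Σg D i j = SignedGraph.adj Σg i j ∧ not (EdgeSubset.del D i j)

Balancing : ∀ {n} (Σg : SignedGraph n) → EdgeSubset Σg → Set
Balancing Σg D = Balanced (deleteEdges Σg D) (SignedGraph.σ Σg)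

IsFrustrationIndex : ∀ {n} → SignedGraph n → ℕ → Set
IsFrustrationIndex Σg e =
  Σ (EdgeSubset Σg) (λ D → Balancing Σg D × countEdges (EdgeSubset.del D) ≡ e)
  × (∀ (D : EdgeSubset Σg) → Balancing Σg D → e Data.Nat.≤ countEdges (EdgeSubset.del D))

induced : ∀ {n} → EdgeRel n → Subset n → EdgeRel n
induced r S i j = r i j ∧ (Data.Vec.lookup S i ∧ Data.Vec.lookup S j)
  where import Data.Vec

IsBalancedClique : ∀ {n} → SignedGraph n → Subset n → Set
IsBalancedClique {n} Σg S =
  (∀ (i j : Fin n) → i ∈ S → j ∈ S → (i ≡ j → Data.Empty.⊥) → T (SignedGraph.adj Σg i j))
  × Balanced (induced (SignedGraph.adj Σg) S) (SignedGraph.σ Σg)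
  where import Data.Empty

IsBalancedCliqueNumber : ∀ {n} → SignedGraph n → ℕ → Set
IsBalancedCliqueNumber Σg w =
  Σ _ (λ S → IsBalancedClique Σg S × ∣ S ∣ ≡ w)
  × (∀ S → IsBalancedClique Σg S → ∣ S ∣ Data.Nat.≤ w)

edgeCount : ∀ {n} → SignedGraph n → ℕ
edgeCount Σg = countEdges (SignedGraph.adj Σg)

module Submission where

-- Delete a minimum balancing edge set D, so |D| = ε. Every clique of the balanced graph G − D is a
-- balanced clique of Σ, hence G − D has clique number at most ω_b, and Turán's theorem bounds
-- 2·ω_b·|E(G − D)| by (ω_b − 1)·n². Turán's theorem is proved by induction on the number of
-- vertices: split off a greedily chosen maximal clique K; every remaining vertex misses some
-- vertex of K, which bounds the edges inside K and between K and the rest.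

open import Defs
open import Data.Nat.Properties
open import Algebra.Properties.CommutativeMonoid.Sum +-0-commutativeMonoid
  using (sum-syntax; sum-cong-≗; ∑-distrib-+; ∑-comm)
open import Algebra.Properties.CommutativeSemigroup +-commutativeSemigroup using (interchange)
open import Data.Bool.Base using (Bool; true; false; T; _∧_; not; if_then_else_)
open import Data.Bool.Properties using (T-∧; T-≡)
open import Data.Fin.Base using (Fin; toℕ) renaming (zero to fzero; suc to fsuc)
open import Data.Fin.Subset using (Subset; ⁅_⁆; _∪_; ∣_∣; inside; outside)
  renaming (_∈_ to _∈ₛ_; _∉_ to _∉ₛ_; ⊥ to ∅)
open import Data.Fin.Subset.Properties using (∪-identityˡ; x∈p∪q⁻; x∈⁅y⁆⇒x≡y; ∉⊥; ∣⊥∣≡0)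
open import Data.List.Base
  using (List; []; _∷_; _++_; [_]; map; length; tabulate; allFin; foldr)
open import Data.List.Properties using (map-++; map-cong; length-++; length-tabulate)
open import Data.List.Membership.Propositional using (_∈_)
open import Data.List.Membership.Propositional.Properties using (∈-length)
open import Data.List.Relation.Binary.Permutation.Propositional
  using (_↭_; prep; ↭-refl; ↭-sym; ↭-trans)
import Data.List.Relation.Binary.Permutation.Propositional.Properties as ↭
open import Data.List.Relation.Binary.Subset.Propositional using (_⊆_)
open import Data.List.Relation.Binary.Subset.Propositional.Properties using (Any-resp-⊆)
open import Data.List.Relation.Unary.All as All using (All; []; _∷_; all?)
open import Data.List.Relation.Unary.All.Properties using (¬All⇒Any¬)
open import Data.List.Relation.Unary.AllPairs as AllPairs using (AllPairs; []; _∷_)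
open import Data.List.Relation.Unary.Any as Any using (Any; here; there)
open import Data.List.Relation.Unary.Unique.Propositional using (Unique)
open import Data.Nat.Base using (ℕ; zero; suc; _+_; _*_; _∸_; _≤_; _<_; z≤n; s≤s; _<ᵇ_)
open import Data.Nat.Induction using (<-wellFounded)
open import Data.Nat.ListAction using (sum)
open import Data.Nat.ListAction.Properties using (sum-++; sum-↭)
open import Data.Nat.Solver using (module +-*-Solver)
open +-*-Solver using (solve; _:=_; _:+_; _:*_; con)
open import Data.Product using (_,_; proj₁)
open import Data.Sum using (inj₁; inj₂)
open import Data.Vec.Base as Vec using (_∷_)
open import Data.Vec.Properties using (lookup⇒[]=)
open import Function.Base using (_∘_; id; _on_)
open import Function.Bundles using (Equivalence)
open import Induction.WellFounded using (Acc; acc)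
import Relation.Binary.Construct.On as On
open import Relation.Binary.PropositionalEquality
  using (_≡_; _≢_; refl; sym; trans; cong; cong₂; subst; subst₂; module ≡-Reasoning)
open import Relation.Nullary using (¬_; yes; no; contradiction)
open import Relation.Nullary.Decidable using (T?)

𝟙 : Bool → ℕ
𝟙 b = if b then 1 else 0

sumMap : {A : Set} → (A → ℕ) → List A → ℕ
sumMap f xs = sum (map f xs)

module _ {A : Set} where

  sumMap-++ : (f : A → ℕ) (xs ys : List A) → sumMap f (xs ++ ys) ≡ sumMap f xs + sumMap f ys
  sumMap-++ f xs ys = trans (cong sum (map-++ f xs ys)) (sum-++ (map f xs) (map f ys))

  sumMap-↭ : (f : A → ℕ) {xs ys : List A} → xs ↭ ys → sumMap f xs ≡ sumMap f ys
  sumMap-↭ f p = sum-↭ (↭.map⁺ f p)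

  sumMap-cong : {f g : A → ℕ} → (∀ x → f x ≡ g x) → (xs : List A) → sumMap f xs ≡ sumMap g xs
  sumMap-cong f≗g xs = cong sum (map-cong f≗g xs)

  sumMap-zero : (xs : List A) → sumMap (λ _ → 0) xs ≡ 0
  sumMap-zero []       = refl
  sumMap-zero (x ∷ xs) = sumMap-zero xs

  sumMap-distrib-+ : (f g : A → ℕ) (xs : List A) →
    sumMap (λ x → f x + g x) xs ≡ sumMap f xs + sumMap g xs
  sumMap-distrib-+ f g []       = refl
  sumMap-distrib-+ f g (x ∷ xs) =
    trans (cong (f x + g x +_) (sumMap-distrib-+ f g xs)) (interchange (f x) (g x) _ _)

  sumMap-comm : (f : A → A → ℕ) (xs ys : List A) →
    sumMap (λ x → sumMap (f x) ys) xs ≡ sumMap (λ y → sumMap (λ x → f x y) xs) ys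
  sumMap-comm f []       ys = sym (sumMap-zero ys)
  sumMap-comm f (x ∷ xs) ys =
    trans (cong (sumMap (f x) ys +_) (sumMap-comm f xs ys))
          (sym (sumMap-distrib-+ (f x) (λ y → sumMap (λ x′ → f x′ y) xs) ys))

scaled-deficit : ∀ {w k x A} → k ≤ w → x + A ≤ x * k → w * A ≤ (w ∸ 1) * (x * k)
scaled-deficit {zero}  _ _ = z≤n
scaled-deficit {suc W} {k} {x} {A} k≤w x+A≤xk = +-cancelˡ-≤ (suc W * x) _ _ (begin
  suc W * x + suc W * A    ≡⟨ *-distribˡ-+ (suc W) x A ⟨
  suc W * (x + A)          ≤⟨ *-monoʳ-≤ (suc W) x+A≤xk ⟩
  x * k + W * (x * k)      ≤⟨ +-monoˡ-≤ (W * (x * k)) (*-monoʳ-≤ x k≤w) ⟩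
  x * suc W + W * (x * k)  ≡⟨ cong (_+ W * (x * k)) (*-comm x (suc W)) ⟩
  suc W * x + W * (x * k)  ∎)
  where open ≤-Reasoning

turán-arithmetic : ∀ {w k m A B C} → k ≤ w → k + A ≤ k * k → m + B ≤ m * k →
  w * C ≤ (w ∸ 1) * (m * m) →
  w * ((A + B) + (B + C)) ≤ (w ∸ 1) * ((k + m) * (k + m))
turán-arithmetic {w} {k} {m} {A} {B} {C} k≤w A-bound B-bound C-bound = begin
  w * ((A + B) + (B + C))            ≡⟨ solve 4 (λ w A B C → w :* ((A :+ B) :+ (B :+ C))
                                          := (w :* A :+ w :* B) :+ (w :* B :+ w :* C)) refl w A B C ⟩
  (w * A + w * B) + (w * B + w * C)  ≤⟨ +-mono-≤ (+-mono-≤ wA wB) (+-mono-≤ wB C-bound) ⟩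
  (W * (k * k) + W * (m * k)) + (W * (m * k) + W * (m * m))
                                     ≡⟨ solve 3 (λ W k m → (W :* (k :* k) :+ W :* (m :* k)) :+ (W :* (m :* k) :+ W :* (m :* m))
                                          := W :* ((k :+ m) :* (k :+ m))) refl W k m ⟩
  W * ((k + m) * (k + m))            ∎
  where
  open ≤-Reasoning
  W = w ∸ 1
  wA = scaled-deficit k≤w A-bound
  wB = scaled-deficit k≤w B-bound

IsClique : {V : Set} → (V → V → Bool) → List V → Set
IsClique adj = AllPairs (λ u v → T (adj u v))

module Turán {V : Set} (adj : V → V → Bool)
             (adj-sym : ∀ u v → adj u v ≡ adj v u)
             (adj-irr : ∀ v → adj v v ≡ false) where

  Adjacent : V → V → Set
  Adjacent u v = T (adj u v)

  HasNonNeighbourIn : List V → V → Set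
  HasNonNeighbourIn K v = Any (¬_ ∘ Adjacent v) K

  degreeIn : V → List V → ℕ
  degreeIn v = sumMap (λ u → 𝟙 (adj v u))

  edgesBetween : List V → List V → ℕ
  edgesBetween A B = sumMap (λ v → degreeIn v B) A

  degreeIn-≤-length : ∀ v B → degreeIn v B ≤ length B
  degreeIn-≤-length v []      = z≤n
  degreeIn-≤-length v (u ∷ B) with adj v u
  ... | true  = s≤s (degreeIn-≤-length v B)
  ... | false = m≤n⇒m≤1+n (degreeIn-≤-length v B)

  degreeIn-<-length : ∀ {v B} → HasNonNeighbourIn B v → degreeIn v B < length B
  degreeIn-<-length {v} {u ∷ B} (here ¬vu) with adj v u
  ... | true  = contradiction _ ¬vu
  ... | false = s≤s (degreeIn-≤-length v B)
  degreeIn-<-length {v} {u ∷ B} (there p) with adj v u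
  ... | true  = s≤s (degreeIn-<-length p)
  ... | false = m≤n⇒m≤1+n (degreeIn-<-length p)

  edgesBetween-bound : ∀ {X K} → All (HasNonNeighbourIn K) X →
    length X + edgesBetween X K ≤ length X * length K
  edgesBetween-bound {[]}     []       = z≤n
  edgesBetween-bound {v ∷ X} {K} (p ∷ ps) = begin
    suc (length X) + (degreeIn v K + edgesBetween X K)
      ≡⟨ solve 3 (λ l d e → con 1 :+ l :+ (d :+ e) := (con 1 :+ d) :+ (l :+ e)) refl
           (length X) (degreeIn v K) (edgesBetween X K) ⟩
    suc (degreeIn v K) + (length X + edgesBetween X K)
      ≤⟨ +-mono-≤ (degreeIn-<-length p) (edgesBetween-bound ps) ⟩
    length K + length X * length K ∎
    where open ≤-Reasoning

  non-neighbour-of-itself : ∀ K → All (HasNonNeighbourIn K) K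
  non-neighbour-of-itself K = All.tabulate (Any.map λ { refl → subst T (adj-irr _) })

  edgesBetween-comm : ∀ A B → edgesBetween A B ≡ edgesBetween B A
  edgesBetween-comm A B = trans (sumMap-comm (λ u v → 𝟙 (adj u v)) A B)
    (sumMap-cong (λ v → sumMap-cong (λ u → cong 𝟙 (adj-sym u v)) A) B)

  edgesBetween-↭ : ∀ {A A′ B B′} → A ↭ A′ → B ↭ B′ → edgesBetween A B ≡ edgesBetween A′ B′
  edgesBetween-↭ {A} {A′} {B} {B′} A↭A′ B↭B′ =
    trans (sumMap-↭ (λ v → degreeIn v B) A↭A′)
          (sumMap-cong (λ v → sumMap-↭ (λ u → 𝟙 (adj v u)) B↭B′) A′)

  edgesBetween-++ : ∀ K R → edgesBetween (K ++ R) (K ++ R) ≡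
    (edgesBetween K K + edgesBetween R K) + (edgesBetween R K + edgesBetween R R)
  edgesBetween-++ K R = begin
    edgesBetween (K ++ R) (K ++ R)
      ≡⟨ sumMap-cong (λ v → sumMap-++ (λ u → 𝟙 (adj v u)) K R) (K ++ R) ⟩
    sumMap (λ v → degreeIn v K + degreeIn v R) (K ++ R)
      ≡⟨ sumMap-++ _ K R ⟩
    sumMap (λ v → degreeIn v K + degreeIn v R) K + sumMap (λ v → degreeIn v K + degreeIn v R) R
      ≡⟨ cong₂ _+_ (sumMap-distrib-+ _ _ K) (sumMap-distrib-+ _ _ R) ⟩
    (edgesBetween K K + edgesBetween K R) + (edgesBetween R K + edgesBetween R R)
      ≡⟨ cong (λ t → (edgesBetween K K + t) + (edgesBetween R K + edgesBetween R R))
              (edgesBetween-comm K R) ⟩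
    (edgesBetween K K + edgesBetween R K) + (edgesBetween R K + edgesBetween R R) ∎
    where open ≡-Reasoning

  clique-adjacent : ∀ {K u v} → IsClique adj K → u ∈ K → v ∈ K → u ≢ v → Adjacent u v
  clique-adjacent (_ ∷ _)  (here refl) (here refl) u≢v = contradiction refl u≢v
  clique-adjacent (p ∷ _)  (here refl) (there v∈K) _   = All.lookup p v∈K
  clique-adjacent (p ∷ _)  (there u∈K) (here refl) _   = subst T (adj-sym _ _) (All.lookup p u∈K)
  clique-adjacent (_ ∷ ps) (there u∈K) (there v∈K) u≢v = clique-adjacent ps u∈K v∈K u≢v

  clique⇒unique : ∀ {K} → IsClique adj K → Unique K
  clique⇒unique = AllPairs.map λ {u} u~v u≡v →
    subst T (trans (cong (adj u) (sym u≡v)) (adj-irr u)) u~v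

  record MaximalCliqueExtension (K L : List V) : Set where
    field
      clique rest : List V
      isClique    : IsClique adj clique
      extends     : K ⊆ clique
      split       : K ++ L ↭ clique ++ rest
      maximal     : All (HasNonNeighbourIn clique) rest

  extendClique : ∀ K → IsClique adj K → ∀ L → MaximalCliqueExtension K L
  extendClique K K-clique [] = record
    { clique = K ; rest = [] ; isClique = K-clique ; extends = id ; split = ↭-refl ; maximal = [] }
  extendClique K K-clique (x ∷ L) with all? (T? ∘ adj x) K
  ... | yes x-K = record
    { MaximalCliqueExtension E
    ; extends = MaximalCliqueExtension.extends E ∘ there
    ; split   = ↭-trans (↭.shift x K L) (MaximalCliqueExtension.split E)
    }
    where E = extendClique (x ∷ K) (x-K ∷ K-clique) L
  ... | no ¬x-K = record
    { MaximalCliqueExtension E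
    ; rest    = x ∷ rest
    ; split   = ↭-trans (↭.shift x K L) (↭-trans (prep x split) (↭-sym (↭.shift x clique rest)))
    ; maximal = Any-resp-⊆ extends (¬All⇒Any¬ (T? ∘ adj x) K ¬x-K) ∷ maximal
    }
    where
    E = extendClique K K-clique L
    open MaximalCliqueExtension E

  module _ {w : ℕ} (clique-bound : ∀ K → IsClique adj K → length K ≤ w) where

    turán : ∀ L → w * edgesBetween L L ≤ (w ∸ 1) * (length L * length L)
    turán L = turán-acc L (On.wellFounded length <-wellFounded L)
      where
      turán-acc : ∀ L → Acc (_<_ on length) L →
        w * edgesBetween L L ≤ (w ∸ 1) * (length L * length L)
      turán-acc []       _         = subst (_≤ (w ∸ 1) * 0) (sym (*-zeroʳ w)) z≤n
      turán-acc (x ∷ xs) (acc rec) =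
        subst₂ (λ e l → w * e ≤ (w ∸ 1) * (l * l)) (sym edges) (sym len)
          (turán-arithmetic (clique-bound clique isClique)
            (edgesBetween-bound (non-neighbour-of-itself clique))
            (edgesBetween-bound maximal)
            (turán-acc rest (rec shorter)))
        where
        open MaximalCliqueExtension (extendClique [ x ] ([] ∷ []) xs)
        len : length (x ∷ xs) ≡ length clique + length rest
        len = trans (↭.↭-length split) (length-++ clique)
        shorter : length rest < length (x ∷ xs)
        shorter = subst (length rest <_) (sym len)
                        (m<n+m (length rest) (∈-length (extends (here refl))))
        edges : edgesBetween (x ∷ xs) (x ∷ xs) ≡
          (edgesBetween clique clique + edgesBetween rest clique) +
          (edgesBetween rest clique + edgesBetween rest rest)
        edges = trans (edgesBetween-↭ split split) (edgesBetween-++ clique rest)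

sumMap-tabulate : ∀ {A : Set} {n} (f : A → ℕ) (g : Fin n → A) →
  sumMap f (tabulate g) ≡ ∑[ i < n ] f (g i)
sumMap-tabulate {n = zero}  f g = refl
sumMap-tabulate {n = suc n} f g = cong (f (g fzero) +_) (sumMap-tabulate f (g ∘ fsuc))

∑-mono-≤ : ∀ {n} {f g : Fin n → ℕ} → (∀ i → f i ≤ g i) → ∑[ i < n ] f i ≤ ∑[ i < n ] g i
∑-mono-≤ {zero}  f≤g = z≤n
∑-mono-≤ {suc n} f≤g = +-mono-≤ (f≤g fzero) (∑-mono-≤ (f≤g ∘ fsuc))

∑₂ : ∀ {n} → (Fin n → Fin n → ℕ) → ℕ
∑₂ {n} f = ∑[ i < n ] ∑[ j < n ] f i j

∑₂-mono-≤ : ∀ {n} {f g : Fin n → Fin n → ℕ} → (∀ i j → f i j ≤ g i j) → ∑₂ f ≤ ∑₂ g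
∑₂-mono-≤ f≤g = ∑-mono-≤ (λ i → ∑-mono-≤ (f≤g i))

∑₂-distrib-+ : ∀ {n} (f g : Fin n → Fin n → ℕ) → ∑₂ (λ i j → f i j + g i j) ≡ ∑₂ f + ∑₂ g
∑₂-distrib-+ {n} f g = trans (sum-cong-≗ (λ i → ∑-distrib-+ (f i) (g i)))
                             (∑-distrib-+ (λ i → ∑[ j < n ] f i j) (λ i → ∑[ j < n ] g i j))

𝟙-<ᵇ-asym : ∀ x y → 𝟙 (x <ᵇ y) + 𝟙 (y <ᵇ x) ≤ 1
𝟙-<ᵇ-asym zero    zero    = z≤n
𝟙-<ᵇ-asym zero    (suc y) = ≤-refl
𝟙-<ᵇ-asym (suc x) zero    = ≤-refl
𝟙-<ᵇ-asym (suc x) (suc y) = 𝟙-<ᵇ-asym x y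

aboveDiagonal : ∀ {n} → EdgeRel n → Fin n → Fin n → ℕ
aboveDiagonal r i j = 𝟙 (r i j ∧ (toℕ i <ᵇ toℕ j))

countEdges-double : ∀ {n} (r : EdgeRel n) → (∀ i j → r i j ≡ r j i) →
  2 * countEdges r ≤ ∑₂ (λ i j → 𝟙 (r i j))
countEdges-double r r-sym = begin
  2 * countEdges r
    ≡⟨ cong (countEdges r +_) (trans (+-identityʳ _) (∑-comm (aboveDiagonal r))) ⟩
  ∑₂ (aboveDiagonal r) + ∑₂ (λ i j → aboveDiagonal r j i)
    ≡⟨ ∑₂-distrib-+ (aboveDiagonal r) (λ i j → aboveDiagonal r j i) ⟨
  ∑₂ (λ i j → aboveDiagonal r i j + aboveDiagonal r j i)
    ≤⟨ ∑₂-mono-≤ (λ i j → subst (λ b → aboveDiagonal r i j + 𝟙 (b ∧ (toℕ j <ᵇ toℕ i)) ≤ 𝟙 (r i j))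
                                (r-sym i j) (one-orientation (r i j) (toℕ i) (toℕ j))) ⟩
  ∑₂ (λ i j → 𝟙 (r i j)) ∎
  where
  open ≤-Reasoning
  one-orientation : ∀ b x y → 𝟙 (b ∧ (x <ᵇ y)) + 𝟙 (b ∧ (y <ᵇ x)) ≤ 𝟙 b
  one-orientation true  = 𝟙-<ᵇ-asym
  one-orientation false _ _ = z≤n

countEdges-split : ∀ {n} (r d : EdgeRel n) →
  countEdges r ≤ countEdges (λ i j → r i j ∧ not (d i j)) + countEdges d
countEdges-split r d =
  ≤-trans (∑₂-mono-≤ λ i j → 𝟙-split (r i j) (d i j) (toℕ i <ᵇ toℕ j))
          (≤-reflexive (∑₂-distrib-+ (aboveDiagonal (λ i j → r i j ∧ not (d i j))) (aboveDiagonal d)))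
  where
  𝟙-split : ∀ a b l → 𝟙 (a ∧ l) ≤ 𝟙 ((a ∧ not b) ∧ l) + 𝟙 (b ∧ l)
  𝟙-split true  true  true  = ≤-refl
  𝟙-split true  false true  = ≤-refl
  𝟙-split true  _     false = z≤n
  𝟙-split false _     _     = z≤n

turán-countEdges : ∀ {n w} (r : EdgeRel n) → (∀ i j → r i j ≡ r j i) → (∀ i → r i i ≡ false) →
  (∀ K → IsClique r K → length K ≤ w) → 2 * w * countEdges r ≤ (w ∸ 1) * (n * n)
turán-countEdges {n} {w} r r-sym r-irr clique-bound = begin
  2 * w * countEdges r                 ≡⟨ cong (_* countEdges r) (*-comm 2 w) ⟩
  w * 2 * countEdges r                 ≡⟨ *-assoc w 2 (countEdges r) ⟩
  w * (2 * countEdges r)               ≤⟨ *-monoʳ-≤ w (countEdges-double r r-sym) ⟩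
  w * ∑₂ (λ i j → 𝟙 (r i j))           ≡⟨ cong (w *_) ordered-pairs ⟨
  w * edgesBetween (allFin n) (allFin n) ≤⟨ turán clique-bound (allFin n) ⟩
  (w ∸ 1) * (length (allFin n) * length (allFin n))
                                       ≡⟨ cong (λ l → (w ∸ 1) * (l * l)) (length-tabulate {n = n} id) ⟩
  (w ∸ 1) * (n * n)                    ∎
  where
  open ≤-Reasoning
  open Turán r r-sym r-irr
  ordered-pairs : edgesBetween (allFin n) (allFin n) ≡ ∑₂ (λ i j → 𝟙 (r i j))
  ordered-pairs = trans (sumMap-tabulate (λ v → degreeIn v (allFin n)) id)
                        (sum-cong-≗ λ i → sumMap-tabulate (λ u → 𝟙 (r i u)) id)

fromList : ∀ {n} → List (Fin n) → Subset n
fromList = foldr (λ i S → ⁅ i ⁆ ∪ S) ∅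

∈-fromList⁻ : ∀ {n} {i : Fin n} K → i ∈ₛ fromList K → i ∈ K
∈-fromList⁻ []      i∈∅ = contradiction i∈∅ ∉⊥
∈-fromList⁻ (k ∷ K) i∈ with x∈p∪q⁻ ⁅ k ⁆ (fromList K) i∈
... | inj₁ i∈⁅k⁆ = here (x∈⁅y⁆⇒x≡y k i∈⁅k⁆)
... | inj₂ i∈K   = there (∈-fromList⁻ K i∈K)

∣⁅x⁆∪p∣≡1+∣p∣ : ∀ {n} (x : Fin n) (p : Subset n) → x ∉ₛ p → ∣ ⁅ x ⁆ ∪ p ∣ ≡ suc ∣ p ∣
∣⁅x⁆∪p∣≡1+∣p∣ fzero    (outside ∷ p) _   = cong (suc ∘ ∣_∣) (∪-identityˡ p)
∣⁅x⁆∪p∣≡1+∣p∣ fzero    (inside  ∷ p) x∉p = contradiction Vec.here x∉p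
∣⁅x⁆∪p∣≡1+∣p∣ (fsuc x) (outside ∷ p) x∉p = ∣⁅x⁆∪p∣≡1+∣p∣ x p (x∉p ∘ Vec.there)
∣⁅x⁆∪p∣≡1+∣p∣ (fsuc x) (inside  ∷ p) x∉p = cong suc (∣⁅x⁆∪p∣≡1+∣p∣ x p (x∉p ∘ Vec.there))

∣fromList∣ : ∀ {n} {K : List (Fin n)} → Unique K → ∣ fromList K ∣ ≡ length K
∣fromList∣ {n} {K = []} [] = ∣⊥∣≡0 n
∣fromList∣ {K = k ∷ K} (k∉K ∷ K-unique) =
  trans (∣⁅x⁆∪p∣≡1+∣p∣ k (fromList K) (λ k∈ → All.lookup k∉K (∈-fromList⁻ K k∈) refl))
        (cong suc (∣fromList∣ K-unique))

balanced-⊆ : ∀ {n} {r r′ : EdgeRel n} {σ} → (∀ {u v} → T (r′ u v) → T (r u v)) →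
  Balanced r σ → Balanced r′ σ
balanced-⊆ r′⊆r r-balanced c =
  r-balanced (record { len = len ; vert = vert ; inj = inj ; edges = r′⊆r ∘ edges })
  where open Cycle c

module _ {n} (Σg : SignedGraph n) (D : EdgeSubset Σg) where
  open SignedGraph Σg
  open EdgeSubset D

  deleteEdges-sym : ∀ i j → deleteEdges Σg D i j ≡ deleteEdges Σg D j i
  deleteEdges-sym i j = cong₂ (λ a d → a ∧ not d) (adj-sym i j) (del-sym i j)

  deleteEdges-irr : ∀ i → deleteEdges Σg D i i ≡ false
  deleteEdges-irr i = cong (_∧ not (del i i)) (adj-irr i)

  balancing-clique⇒balancedClique : Balancing Σg D → ∀ {K} → IsClique (deleteEdges Σg D) K →
    IsBalancedClique Σg (fromList K)
  balancing-clique⇒balancedClique balancing {K} K-clique =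
    (λ i j i∈K j∈K i≢j → remaining⇒edge (adjacent i∈K j∈K i≢j)) ,
    balanced-⊆ {σ = σ} induced⇒remaining balancing
    where
    open Turán (deleteEdges Σg D) deleteEdges-sym deleteEdges-irr
    remaining⇒edge : ∀ {u v} → T (deleteEdges Σg D u v) → T (adj u v)
    remaining⇒edge = proj₁ ∘ Equivalence.to T-∧
    adjacent : ∀ {u v} → u ∈ₛ fromList K → v ∈ₛ fromList K → u ≢ v → T (deleteEdges Σg D u v)
    adjacent u∈K v∈K = clique-adjacent K-clique (∈-fromList⁻ K u∈K) (∈-fromList⁻ K v∈K)
    member : ∀ {u} → T (Vec.lookup (fromList K) u) → u ∈ₛ fromList K
    member {u} t = lookup⇒[]= u (fromList K) (Equivalence.to T-≡ t)
    induced⇒remaining : ∀ {u v} → T (induced adj (fromList K) u v) → T (deleteEdges Σg D u v)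
    induced⇒remaining {u} {v} t with Equivalence.to (T-∧ {adj u v}) t
    ... | uv , u∈v∈ with Equivalence.to T-∧ u∈v∈
    ...   | u∈ , v∈ = adjacent (member u∈) (member v∈) λ { refl → subst T (adj-irr u) uv }

  balancing-clique-bound : Balancing Σg D → ∀ {w} → (∀ S → IsBalancedClique Σg S → ∣ S ∣ ≤ w) →
    ∀ K → IsClique (deleteEdges Σg D) K → length K ≤ w
  balancing-clique-bound balancing {w} maximum K K-clique =
    subst (_≤ w) (∣fromList∣ (clique⇒unique K-clique))
          (maximum (fromList K) (balancing-clique⇒balancedClique balancing K-clique))
    where open Turán (deleteEdges Σg D) deleteEdges-sym deleteEdges-irr

mainTheorem4 : ∀ (n : ℕ) (Σg : SignedGraph n) (e w : ℕ) →
    IsFrustrationIndex Σg e → IsBalancedCliqueNumber Σg w →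
    2 * w * edgeCount Σg ≤ 2 * w * e + n * n * (w ∸ 1)
mainTheorem4 n Σg e w ((D , balancing , ∣D∣≡e) , _) (_ , maximum) = begin
  2 * w * edgeCount Σg                             ≤⟨ *-monoʳ-≤ (2 * w) (countEdges-split adj del) ⟩
  2 * w * (countEdges remaining + countEdges del)  ≡⟨ *-distribˡ-+ (2 * w) (countEdges remaining) _ ⟩
  2 * w * countEdges remaining + 2 * w * countEdges del
    ≤⟨ +-mono-≤ (turán-countEdges remaining (deleteEdges-sym Σg D) (deleteEdges-irr Σg D)
                   (balancing-clique-bound Σg D balancing maximum))
                (≤-reflexive (cong (2 * w *_) ∣D∣≡e)) ⟩
  (w ∸ 1) * (n * n) + 2 * w * e                    ≡⟨ +-comm _ (2 * w * e) ⟩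
  2 * w * e + (w ∸ 1) * (n * n)                    ≡⟨ cong (2 * w * e +_) (*-comm (w ∸ 1) (n * n)) ⟩
  2 * w * e + n * n * (w ∸ 1)                      ∎
  where
  open ≤-Reasoning
  open SignedGraph Σg
  open EdgeSubset D
  remaining : EdgeRel n
  remaining = deleteEdges Σg D
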